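{- The following two statements are equivalent: (A) For every connected graph $G$ and every $\mathcal{P}\subseteq\mathcal{L}(G)$ with $|\mathcal{P}|=3$, $f(G,\mathcal{P})=0$ (i.e. any three longest paths of a connected graph have a common vertex). (B) There exists a non-decreasing function $g$ with $\lim_{n\to\infty} g(n)/n=0$ such that for every connected graph $G$ of order $n$ and every $\mathcal{P}\subseteq\mathcal{L}(G)$ with $|\mathcal{P}|=3$, $f(G,\mathcal{P})\leq g(n)$.
   Context: All graphs are finite and simple. For a connected graph $G$, $l(G)$ is the length (number of edges) of a longest path in $G$ and $\mathcal{L}(G)$ is the set of paths in $G$ with exactly $l(G)+1$ vertices (the longest paths). $d_G(x,y)$ is the distance in $G$, and for $U\subseteq V(G)$, $d_G(x,U)=\min_{y\in U} d_G(x,y)$. For $\mathcal{P}\subseteq\mathcal{L}(G)$, $f(G,\mathcal{P})=\min\{\sum_{P\in\mathcal{P}} d_G(v,V(P))\mid v\in V(G)\}$. -}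

module Defs where

open import Data.Nat using (ℕ; zero; suc; _+_; _*_; _≤_; _<_; _⊓_)
open import Data.Fin using (Fin; _≟_)
open import Data.Bool using (Bool; true; false; _∨_; _∧_; if_then_else_)
open import Data.List using (List; []; _∷_; length; reverse; allFin; map; foldr)
open import Data.Bool.ListAction using (any)
open import Data.Nat.ListAction using (sum)
open import Data.List.Relation.Unary.Unique.Propositional using (Unique)
open import Data.List.Relation.Unary.Linked using (Linked)
open import Data.Product using (Σ; _×_; ∃)
open import Data.Sum using (_⊎_)
open import Relation.Binary.PropositionalEquality using (_≡_; _≢_)
open import Relation.Nullary using (¬_)
open import Relation.Nullary.Decidable using (⌊_⌋)

record Graph (n : ℕ) : Set where
  field
    adj    : Fin n → Fin n → Bool
    sym    : ∀ x y → adj x y ≡ adj y x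
    irrefl : ∀ x → adj x x ≡ false
open Graph public

module _ {n : ℕ} (G : Graph n) where

  Adj : Fin n → Fin n → Set
  Adj x y = adj G x y ≡ true

  data Walk : Fin n → Fin n → Set where
    here : ∀ {x} → Walk x x
    step : ∀ {x y z} → Adj x y → Walk y z → Walk x z

  Connected : Set
  Connected = (0 < n) × (∀ x y → Walk x y)

  IsPath : List (Fin n) → Set
  IsPath P = (P ≢ []) × Unique P × Linked Adj P

  IsLongest : List (Fin n) → Set
  IsLongest P = IsPath P × (∀ Q → IsPath Q → length Q ≤ length P)

  reach : ℕ → Fin n → Fin n → Bool
  reach zero x y = ⌊ x ≟ y ⌋
  reach (suc k) x y = reach k x y ∨ any (λ z → reach k x z ∧ adj G z y) (allFin n)

  distAux : Fin n → List (Fin n) → ℕ → ℕ → ℕ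
  distAux x U k zero = k
  distAux x U k (suc fuel) = if any (reach k x) U then k else distAux x U (suc k) fuel

  -- d_G(x, U)  (correct whenever G is connected and U nonempty, since then d < n)
  dist : Fin n → List (Fin n) → ℕ
  dist x U = distAux x U 0 n

minimumℕ : List ℕ → ℕ
minimumℕ [] = 0
minimumℕ (m ∷ ms) = foldr _⊓_ m ms

f : ∀ {n} → Graph n → List (List (Fin n)) → ℕ
f {n} G Ps = minimumℕ (map (λ v → sum (map (dist G v) Ps)) (allFin n))

-- two vertex sequences describe the same path (a path and its reverse coincide)
SamePath : ∀ {n} → List (Fin n) → List (Fin n) → Set
SamePath P Q = (P ≡ Q) ⊎ (P ≡ reverse Q)

-- Hypothesis shared by (A) and (B): G connected of order n, 𝒫 = {P₁,P₂,P₃} ⊆ 𝓛(G), |𝒫| = 3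
ThreeLongest : ∀ {n} → Graph n → List (Fin n) → List (Fin n) → List (Fin n) → Set
ThreeLongest G P₁ P₂ P₃ =
  Connected G × IsLongest G P₁ × IsLongest G P₂ × IsLongest G P₃ ×
  ¬ SamePath P₁ P₂ × ¬ SamePath P₁ P₃ × ¬ SamePath P₂ P₃

StatementA : Set
StatementA = ∀ n (G : Graph n) (P₁ P₂ P₃ : List (Fin n)) →
  ThreeLongest G P₁ P₂ P₃ → f G (P₁ ∷ P₂ ∷ P₃ ∷ []) ≡ 0

NonDecreasing : (ℕ → ℕ) → Set
NonDecreasing g = ∀ m n → m ≤ n → g m ≤ g n

-- lim g(n)/n = 0 : for every k, eventually g(n) ≤ n/k
SublinearLimit : (ℕ → ℕ) → Set
SublinearLimit g = ∀ k → ∃ λ N → ∀ n → N ≤ n → k * g n ≤ n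

StatementB : Set
StatementB = Σ (ℕ → ℕ) λ g → NonDecreasing g × SublinearLimit g ×
  (∀ n (G : Graph n) (P₁ P₂ P₃ : List (Fin n)) →
     ThreeLongest G P₁ P₂ P₃ → f G (P₁ ∷ P₂ ∷ P₃ ∷ []) ≤ g n)

module Submission where

-- (A) ⇒ (B) is immediate with g = 0.  For (B) ⇒ (A) we blow up a
-- counterexample.  Given G of order n with three longest paths P₁,P₂,P₃
-- without a common vertex and a parameter h, the graph G⁺ replaces every
-- edge ab by a path with M = 2h interior vertices and hangs, at every
-- vertex a, pendant paths of M vertices (one for each b such that ab is
-- not an edge with a < b).
-- Then:
--   * G⁺ is connected and has order N = n + n²M = O(h);
--   * a path of G⁺ visits at most M + 1 vertices per vertex of G it visits
--     plus one pendant run, so longest paths of G⁺ come from longest paths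
--     of G, and the expansions P⁺ᵢ (pendant + subdivided Pᵢ + pendant) are
--     three distinct longest paths of G⁺;
--   * every vertex u of G⁺ has an original vertex e "near" it, and e misses
--     some Pᵢ; a 1-Lipschitz potential vanishing on P⁺ᵢ shows d(u, P⁺ᵢ) ≥ h.
-- Hence f(G⁺) ≥ h ≈ N / (2n²), contradicting g(N) = o(N) for h large.

open import Defs hiding (sym)
open import Function.Bundles using (_⇔_; mk⇔)
open import Function.Base using (_∘′_)
open import Data.Nat using (ℕ; zero; suc; _+_; _*_; _≤_; _<_; _⊓_; z≤n; s≤s; _∸_; _<?_)
open import Data.Nat.Properties hiding (_≟_)
import Data.Nat.Properties as ℕP
open import Data.Nat.Tactic.RingSolver using (solve-∀)
open import Data.Fin using (Fin; _≟_; toℕ; _↑ˡ_; _↑ʳ_; splitAt; join; combine; remQuot)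
  renaming (zero to fz; suc to fs)
open import Data.Fin.Properties using (splitAt-↑ˡ; splitAt-↑ʳ; join-splitAt; remQuot-combine; combine-remQuot; toℕ-injective; toℕ<n; any?)
import Data.Bool as B
open import Data.Bool using (Bool; true; false; _∨_; _∧_)
open import Data.List using (List; []; _∷_; length; reverse; allFin; map; foldr; _++_; [_])
open import Data.List.Properties using (length-++; length-map; length-tabulate; ++-assoc; ++-identityʳ; reverse-map; unfold-reverse; map-∘; map-cong; map-id)
open import Data.Bool.ListAction using (any)
open import Data.Nat.ListAction using (sum)
open import Data.List.Membership.Propositional using (_∈_; _∉_; find)
open import Data.List.Membership.Propositional.Properties using (∈-∃++; ∈-allFin; ∈-map⁺; ∈-map⁻; ∈-++⁻; ∈-++⁺ˡ; ∈-++⁺ʳ)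
open import Data.List.Relation.Unary.Any using (Any; here; there)
open import Data.List.Relation.Unary.All using (All; _∷_; []; lookup; tabulate)
import Data.List.Relation.Unary.All as All
open import Data.List.Relation.Unary.All.Properties using (¬All⇒Any¬)
open import Data.List.Relation.Unary.Unique.Propositional using (Unique; _∷_; [])
import Data.List.Relation.Unary.Unique.Propositional.Properties as UniqueP
open import Data.List.Relation.Unary.Linked using (Linked; _∷_; []; [-])
import Data.List.Relation.Unary.Linked as Linked
import Data.List.Relation.Unary.Linked.Properties as LinkedP
open import Data.Product using (Σ; _×_; ∃; _,_; proj₁; proj₂)
open import Data.Sum using (_⊎_; inj₁; inj₂; [_,_]′)
open import Data.Empty using (⊥; ⊥-elim)
open import Relation.Binary.PropositionalEquality hiding ([_])
open import Relation.Nullary using (¬_; yes; no; Dec)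
open import Relation.Nullary.Decidable using (⌊_⌋; _×-dec_; _⊎-dec_)

any-true⇒ : ∀ {A : Set} (p : A → Bool) (xs : List A) → any p xs ≡ true → ∃ λ x → x ∈ xs × p x ≡ true
any-true⇒ p [] ()
any-true⇒ p (x ∷ xs) e with p x in px
... | true = x , here refl , px
... | false with any-true⇒ p xs e
... | y , y∈ , py = y , there y∈ , py

⇒any-true : ∀ {A : Set} (p : A → Bool) {xs : List A} {x} → x ∈ xs → p x ≡ true → any p xs ≡ true
⇒any-true p {x ∷ xs} (here refl) px rewrite px = refl
⇒any-true p {x ∷ xs} (there m) px with p x
... | true = refl
... | false = ⇒any-true p m px

∨-true : ∀ {a b} → (a ∨ b) ≡ true → (a ≡ true) ⊎ (b ≡ true)
∨-true {true} e = inj₁ refl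
∨-true {false} e = inj₂ e

∧-true : ∀ {a b} → (a ∧ b) ≡ true → (a ≡ true) × (b ≡ true)
∧-true {true} {true} e = refl , refl

dec-true : ∀ {P : Set} (d : Dec P) → ⌊ d ⌋ ≡ true → P
dec-true (yes p) _ = p
dec-true (no _) ()

foldr⊓-glb : ∀ h m ms → h ≤ m → All (h ≤_) ms → h ≤ foldr _⊓_ m ms
foldr⊓-glb h m [] hm [] = hm
foldr⊓-glb h m (x ∷ ms) hm (hx ∷ hs) = ⊓-glb hx (foldr⊓-glb h m ms hm hs)

minimum-glb : ∀ h (xs : List ℕ) → All (h ≤_) xs → xs ≢ [] → h ≤ minimumℕ xs
minimum-glb h [] _ ne = ⊥-elim (ne refl)
minimum-glb h (x ∷ xs) (hx ∷ hs) _ = foldr⊓-glb h x xs hx hs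

minimum-zero : ∀ (xs : List ℕ) → 0 ∈ xs → minimumℕ xs ≡ 0
minimum-zero xs 0∈ = n≤0⇒n≡0 (go xs 0∈)
  where
  go : ∀ xs → 0 ∈ xs → minimumℕ xs ≤ 0
  go (x ∷ ms) (here refl) = foldr-≤ 0 ms ≤-refl
    where
    foldr-≤ : ∀ m ms → m ≤ 0 → foldr _⊓_ m ms ≤ 0
    foldr-≤ m [] le = le
    foldr-≤ m (y ∷ ms) le = ≤-trans (m⊓n≤n y (foldr _⊓_ m ms)) (foldr-≤ m ms le)
  go (x ∷ y ∷ ms) (there (here refl)) = m⊓n≤m 0 (foldr _⊓_ x ms)
  go (x ∷ y ∷ ms) (there (there p)) = ≤-trans (m⊓n≤n y (foldr _⊓_ x ms)) (go (x ∷ ms) (there p))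

∈⇒≤sum : ∀ {d ds} → d ∈ ds → d ≤ sum ds
∈⇒≤sum {ds = d ∷ ds} (here refl) = m≤m+n d (sum ds)
∈⇒≤sum {ds = d′ ∷ ds} (there m) = ≤-trans (∈⇒≤sum m) (m≤n+m (sum ds) d′)

map-allFin-nonempty : ∀ {m} {A : Set} (F : Fin m → A) → 0 < m → map F (allFin m) ≢ []
map-allFin-nonempty {suc m} F _ ()

unique-length-≤ : ∀ {A : Set} (xs ys : List A) → Unique xs → (∀ {x} → x ∈ xs → x ∈ ys) → length xs ≤ length ys
unique-length-≤ [] ys _ _ = z≤n
unique-length-≤ (x ∷ xs) ys (x∉ ∷ u) sub with ∈-∃++ (sub (here refl))
... | us , vs , refl = begin
    suc (length xs)          ≤⟨ s≤s (unique-length-≤ xs (us ++ vs) u sub′) ⟩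
    suc (length (us ++ vs))  ≡⟨ cong suc (length-++ us) ⟩
    suc (length us + length vs) ≡⟨ sym (+-suc (length us) (length vs)) ⟩
    length us + length (x ∷ vs) ≡⟨ sym (length-++ us) ⟩
    length (us ++ x ∷ vs)    ∎
  where
  open ≤-Reasoning
  sub′ : ∀ {y} → y ∈ xs → y ∈ us ++ vs
  sub′ {y} y∈ with ∈-++⁻ us (sub (there y∈))
  ... | inj₁ p = ∈-++⁺ˡ p
  ... | inj₂ (here refl) = ⊥-elim (lookup x∉ y∈ refl)
  ... | inj₂ (there p) = ∈-++⁺ʳ us p

-- A potential ψ that changes by at most 1 along edges and vanishes on U
-- bounds the distance to U from below (capped by the order N, the search
-- range of `dist`).
module DistanceLowerBound {N : ℕ} (H : Graph N) (ψ : Fin N → ℕ)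
                          (ψ-lipschitz : ∀ x y → Adj H x y → ψ x ≤ suc (ψ y)) where

  reach-lipschitz : ∀ r x y → reach H r x y ≡ true → ψ x ≤ r + ψ y
  reach-lipschitz zero x y e with dec-true (x ≟ y) e
  ... | refl = ≤-refl
  reach-lipschitz (suc r) x y e with ∨-true {reach H r x y} e
  ... | inj₁ e₁ = ≤-trans (reach-lipschitz r x y e₁) (n≤1+n _)
  ... | inj₂ e₂ with any-true⇒ _ (allFin N) e₂
  ... | z , _ , ez with ∧-true {reach H r x z} ez
  ... | rxz , zy = begin
      ψ x           ≤⟨ reach-lipschitz r x z rxz ⟩
      r + ψ z       ≤⟨ +-monoʳ-≤ r (ψ-lipschitz z y zy) ⟩
      r + suc (ψ y) ≡⟨ +-suc r (ψ y) ⟩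
      suc r + ψ y   ∎
    where open ≤-Reasoning

  distAux-≥ : ∀ (U : List (Fin N)) x h → (∀ u → u ∈ U → ψ u ≡ 0) → h ≤ ψ x →
              ∀ fuel k → h ≤ k + fuel → h ≤ distAux H x U k fuel
  distAux-≥ U x h U0 hx zero k le = ≤-trans le (≤-reflexive (+-identityʳ k))
  distAux-≥ U x h U0 hx (suc fuel) k le with any (reach H k x) U in e
  ... | true with any-true⇒ _ U e
  ... | u , u∈ , ru = ≤-trans hx (≤-trans (reach-lipschitz k x u ru) (≤-reflexive (trans (cong (k +_) (U0 u u∈)) (+-identityʳ k))))
  distAux-≥ U x h U0 hx (suc fuel) k le | false = distAux-≥ U x h U0 hx fuel (suc k) (≤-trans le (≤-reflexive (+-suc k fuel)))

  dist-≥ : ∀ (U : List (Fin N)) x h → (∀ u → u ∈ U → ψ u ≡ 0) → h ≤ ψ x → h ≤ N → h ≤ dist H x U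
  dist-≥ U x h U0 hx hN = distAux-≥ U x h U0 hx N 0 hN

reach-self : ∀ {n} (G : Graph n) x → reach G 0 x x ≡ true
reach-self G x with x ≟ x
... | yes _ = refl
... | no x≢x = ⊥-elim (x≢x refl)

dist-zero : ∀ {n} (G : Graph n) x (U : List (Fin n)) → x ∈ U → dist G x U ≡ 0
dist-zero {suc _} G x U x∈ rewrite ⇒any-true (reach G 0 x) x∈ (reach-self G x) = refl

module _ {n : ℕ} (G : Graph n) where

  f-common-vertex : ∀ (Ps : List (List (Fin n))) v → All (v ∈_) Ps → f G Ps ≡ 0
  f-common-vertex Ps v v∈Ps = minimum-zero (map F (allFin n)) (subst (_∈ map F (allFin n)) (Fv≡0 Ps v∈Ps) (∈-map⁺ F (∈-allFin v)))
    where
    F : Fin n → ℕ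
    F w = sum (map (dist G w) Ps)
    Fv≡0 : ∀ Qs → All (v ∈_) Qs → sum (map (dist G v) Qs) ≡ 0
    Fv≡0 [] [] = refl
    Fv≡0 (Q ∷ Qs) (v∈Q ∷ v∈Qs) rewrite dist-zero G v Q v∈Q = Fv≡0 Qs v∈Qs

  walk-++ : ∀ {x y z} → Walk G x y → Walk G y z → Walk G x z
  walk-++ here w = w
  walk-++ (step a w) w′ = step a (walk-++ w w′)

  walk-reverse : ∀ {x y} → Walk G x y → Walk G y x
  walk-reverse here = here
  walk-reverse (step {x} {y} a w) = walk-++ (walk-reverse w) (step (trans (Graph.sym G y x) a) here)

  adj-irrefl : ∀ {x y} → Adj G x y → x ≢ y
  adj-irrefl {x} xy refl with trans (sym xy) (Graph.irrefl G x)
  ... | ()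

  -- Two distinct paths provide two distinct vertices, and then, in a
  -- connected graph, an edge; so a longest path has at least 2 vertices.
  distinct-vertices : ∀ P Q → IsPath G P → IsPath G Q → P ≢ Q → Σ (Fin n) λ x → Σ (Fin n) λ y → x ≢ y
  distinct-vertices [] _ (ne , _) _ _ = ⊥-elim (ne refl)
  distinct-vertices _ [] _ (ne , _) _ = ⊥-elim (ne refl)
  distinct-vertices (p ∷ q ∷ _) _ (_ , (p∉ ∷ _) , _) _ _ = p , q , lookup p∉ (here refl)
  distinct-vertices (p ∷ []) (q ∷ q′ ∷ _) _ (_ , (q∉ ∷ _) , _) _ = q , q′ , lookup q∉ (here refl)
  distinct-vertices (p ∷ []) (q ∷ []) _ _ ne = p , q , λ e → ne (cong [_] e)

  longest-nontrivial : Connected G → ∀ {P x y} → IsLongest G P → x ≢ y → 2 ≤ length P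
  longest-nontrivial (_ , walks) {P} {x} {y} (_ , longest) x≢y = first-edge (walks x y) x≢y
    where
    first-edge : ∀ {z} → Walk G x z → x ≢ z → 2 ≤ length P
    first-edge here ne = ⊥-elim (ne refl)
    first-edge (step {y = z} xz _) _ =
      longest (x ∷ z ∷ []) ((λ ()) , ((adj-irrefl xz ∷ []) ∷ [] ∷ []) , xz ∷ [-])

≤-*-positive : ∀ {m} → 0 < m → ∀ x → x ≤ m * x
≤-*-positive {suc m} _ x = m≤m+n x (m * x)

-- Its vertices are the
-- original vertices `orig a` and, for every ordered pair (a, b), a run of
-- M = 2h new vertices `mid a b t` (t < M).  If ab is an edge with a < b the
-- run subdivides it (mid a b 0 touches a, mid a b (M-1) touches b);
-- otherwise it is a pendant path hanging at a.
module Blowup {n : ℕ} (G : Graph n) (h′ : ℕ) where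

  h M M₀ : ℕ
  h = suc h′
  M = h + h
  M₀ = h′ + h   -- M = suc M₀, the largest position in a run

  data V : Set where
    orig : Fin n → V
    mid  : Fin n → Fin n → Fin M → V

  orig-injective : ∀ {a b} → orig a ≡ orig b → a ≡ b
  orig-injective refl = refl

  mid-injective : ∀ {a b t a′ b′ t′} → mid a b t ≡ mid a′ b′ t′ → (a ≡ a′) × (b ≡ b′) × (t ≡ t′)
  mid-injective refl = refl , refl , refl

  _≟V_ : (x y : V) → Dec (x ≡ y)
  orig a ≟V orig b with a ≟ b
  ... | yes refl = yes refl
  ... | no ne = no λ e → ne (orig-injective e)
  orig a ≟V mid _ _ _ = no λ ()
  mid _ _ _ ≟V orig _ = no λ ()
  mid a b t ≟V mid a′ b′ t′ with a ≟ a′ | b ≟ b′ | t ≟ t′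
  ... | yes refl | yes refl | yes refl = yes refl
  ... | no ne | _ | _ = no λ e → ne (proj₁ (mid-injective e))
  ... | yes _ | no ne | _ = no λ e → ne (proj₁ (proj₂ (mid-injective e)))
  ... | yes _ | yes _ | no ne = no λ e → ne (proj₂ (proj₂ (mid-injective e)))

  -- ab is an edge that gets subdivided (each edge is counted once: a < b).
  SubEdge : Fin n → Fin n → Set
  SubEdge a b = (toℕ a < toℕ b) × Adj G a b

  SubEdge? : ∀ a b → Dec (SubEdge a b)
  SubEdge? a b = (toℕ a <? toℕ b) ×-dec (adj G a b B.≟ true)

  Attached : Fin n → Fin n → Fin n → Fin M → Set
  Attached o a b t = ((o ≡ a) × (toℕ t ≡ 0)) ⊎ (SubEdge a b × (o ≡ b) × (suc (toℕ t) ≡ M))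

  Attached? : ∀ o a b t → Dec (Attached o a b t)
  Attached? o a b t = ((o ≟ a) ×-dec (toℕ t ℕP.≟ 0)) ⊎-dec (SubEdge? a b ×-dec ((o ≟ b) ×-dec (suc (toℕ t) ℕP.≟ M)))

  Consecutive : Fin M → Fin M → Set
  Consecutive t t′ = (suc (toℕ t) ≡ toℕ t′) ⊎ (suc (toℕ t′) ≡ toℕ t)

  Adj⁺ : V → V → Set
  Adj⁺ (orig _) (orig _) = ⊥
  Adj⁺ (orig o) (mid a b t) = Attached o a b t
  Adj⁺ (mid a b t) (orig o) = Attached o a b t
  Adj⁺ (mid a b t) (mid a′ b′ t′) = (a ≡ a′) × (b ≡ b′) × Consecutive t t′

  Adj⁺? : ∀ x y → Dec (Adj⁺ x y)
  Adj⁺? (orig _) (orig _) = no λ ()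
  Adj⁺? (orig o) (mid a b t) = Attached? o a b t
  Adj⁺? (mid a b t) (orig o) = Attached? o a b t
  Adj⁺? (mid a b t) (mid a′ b′ t′) = (a ≟ a′) ×-dec ((b ≟ b′) ×-dec ((suc (toℕ t) ℕP.≟ toℕ t′) ⊎-dec (suc (toℕ t′) ℕP.≟ toℕ t)))

  Adj⁺-sym : ∀ x y → Adj⁺ x y → Adj⁺ y x
  Adj⁺-sym (orig _) (mid _ _ _) p = p
  Adj⁺-sym (mid _ _ _) (orig _) p = p
  Adj⁺-sym (mid a b t) (mid a′ b′ t′) (refl , refl , inj₁ e) = refl , refl , inj₂ e
  Adj⁺-sym (mid a b t) (mid a′ b′ t′) (refl , refl , inj₂ e) = refl , refl , inj₁ e

  Adj⁺-irrefl : ∀ x → ¬ Adj⁺ x x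
  Adj⁺-irrefl (mid a b t) (_ , _ , inj₁ e) = 1+n≢n e
  Adj⁺-irrefl (mid a b t) (_ , _ , inj₂ e) = 1+n≢n e

  -- V is enumerated by Fin N through the mutually inverse enc and dec.
  N : ℕ
  N = n + n * (n * M)

  h≤N : 0 < n → h ≤ N
  h≤N 0<n = begin
    h              ≤⟨ m≤m+n h h ⟩
    M              ≤⟨ ≤-*-positive 0<n M ⟩
    n * M          ≤⟨ ≤-*-positive 0<n (n * M) ⟩
    n * (n * M)    ≤⟨ m≤n+m _ n ⟩
    N              ∎
    where open ≤-Reasoning

  enc : V → Fin N
  enc (orig a) = a ↑ˡ (n * (n * M))
  enc (mid a b t) = n ↑ʳ combine a (combine b t)

  midOf : Fin n × Fin (n * M) → V
  midOf (a , z) = let (b , t) = remQuot {n} M z in mid a b t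

  decMid : Fin (n * (n * M)) → V
  decMid y = midOf (remQuot {n} (n * M) y)

  dec : Fin N → V
  dec x = [ orig , decMid ]′ (splitAt n x)

  dec-enc : ∀ v → dec (enc v) ≡ v
  dec-enc (orig a) rewrite splitAt-↑ˡ n a (n * (n * M)) = refl
  dec-enc (mid a b t) rewrite splitAt-↑ʳ n (n * (n * M)) (combine a (combine b t)) =
    trans (cong midOf (remQuot-combine {n} {n * M} a (combine b t)))
          (cong (λ (q : Fin n × Fin M) → mid a (proj₁ q) (proj₂ q)) (remQuot-combine {n} {M} b t))

  enc-decMid : ∀ y → enc (decMid y) ≡ n ↑ʳ y
  enc-decMid y = cong (n ↑ʳ_) (trans (cong (combine a) (combine-remQuot {n} M z)) (combine-remQuot {n} (n * M) y))
    where
    a = proj₁ (remQuot {n} (n * M) y)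
    z = proj₂ (remQuot {n} (n * M) y)

  enc-dec : ∀ x → enc (dec x) ≡ x
  enc-dec x with splitAt n x in e
  ... | inj₁ a = trans (cong (join n _) (sym e)) (join-splitAt n _ x)
  ... | inj₂ y = trans (enc-decMid y) (trans (cong (join n _) (sym e)) (join-splitAt n _ x))

  dec-injective : ∀ {x y} → dec x ≡ dec y → x ≡ y
  dec-injective {x} {y} e = trans (sym (enc-dec x)) (trans (cong enc e) (enc-dec y))

  enc-injective : ∀ {u v} → enc u ≡ enc v → u ≡ v
  enc-injective {u} {v} e = trans (sym (dec-enc u)) (trans (cong dec e) (dec-enc v))

  adj⁺ : V → V → Bool
  adj⁺ x y = ⌊ Adj⁺? x y ⌋

  adj⁺-sym : ∀ x y → adj⁺ x y ≡ adj⁺ y x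
  adj⁺-sym x y with Adj⁺? x y | Adj⁺? y x
  ... | yes _ | yes _ = refl
  ... | no _ | no _ = refl
  ... | yes p | no q = ⊥-elim (q (Adj⁺-sym x y p))
  ... | no p | yes q = ⊥-elim (p (Adj⁺-sym y x q))

  adj⁺-irrefl : ∀ x → adj⁺ x x ≡ false
  adj⁺-irrefl x with Adj⁺? x x
  ... | yes p = ⊥-elim (Adj⁺-irrefl x p)
  ... | no _ = refl

  G⁺ : Graph N
  G⁺ = record { adj = λ x y → adj⁺ (dec x) (dec y)
              ; sym = λ x y → adj⁺-sym (dec x) (dec y)
              ; irrefl = λ x → adj⁺-irrefl (dec x) }

  Adj⇒Adj⁺ : ∀ x y → Adj G⁺ x y → Adj⁺ (dec x) (dec y)
  Adj⇒Adj⁺ x y e = dec-true (Adj⁺? (dec x) (dec y)) e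

  Adj⁺⇒Adj : ∀ u v → Adj⁺ u v → Adj G⁺ (enc u) (enc v)
  Adj⁺⇒Adj u v p rewrite dec-enc u | dec-enc v with Adj⁺? u v
  ... | yes _ = refl
  ... | no ¬p = ⊥-elim (¬p p)

  -- Positions in a run are addressed by natural numbers j ≤ M₀ via the
  -- clamping map `clamp`, which is a section of toℕ on that range.
  clamp : ∀ m → ℕ → Fin (suc m)
  clamp m zero = fz
  clamp zero (suc j) = fz
  clamp (suc m) (suc j) = fs (clamp m j)

  toℕ-clamp : ∀ m j → j ≤ m → toℕ (clamp m j) ≡ j
  toℕ-clamp m zero _ = refl
  toℕ-clamp (suc m) (suc j) (s≤s le) = cong suc (toℕ-clamp m j le)

  toℕ≤M₀ : (t : Fin M) → toℕ t ≤ M₀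
  toℕ≤M₀ t = ≤-pred (toℕ<n t)

  clamp-toℕ : (t : Fin M) → clamp M₀ (toℕ t) ≡ t
  clamp-toℕ t = toℕ-injective (toℕ-clamp M₀ (toℕ t) (toℕ≤M₀ t))

  at : Fin n → Fin n → ℕ → V
  at a b j = mid a b (clamp M₀ j)

  at-up : ∀ a b j → suc j ≤ M₀ → Adj⁺ (at a b j) (at a b (suc j))
  at-up a b j le = refl , refl , inj₁ (trans (cong suc (toℕ-clamp M₀ j (≤-trans (n≤1+n j) le))) (sym (toℕ-clamp M₀ (suc j) le)))

  at-down : ∀ a b j → suc j ≤ M₀ → Adj⁺ (at a b (suc j)) (at a b j)
  at-down a b j le = Adj⁺-sym (at a b j) (at a b (suc j)) (at-up a b j le)

  at-last : ∀ a b → SubEdge a b → Adj⁺ (orig b) (at a b M₀)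
  at-last a b ab = inj₂ (ab , refl , cong suc (toℕ-clamp M₀ M₀ ≤-refl))

  subEdge-flip : ∀ {p q} → Adj G p q → ¬ (toℕ p < toℕ q) → SubEdge q p
  subEdge-flip {p} {q} pq ¬p<q = ≤∧≢⇒< (≮⇒≥ ¬p<q) (λ e → adj-irrefl G pq (sym (toℕ-injective e))) , trans (Graph.sym G q p) pq

  -- G⁺ is connected when G is: each run walks down to its start, and each
  -- edge of G becomes a walk through its subdivision.
  module Connectivity where

    walk⁺ : ∀ u v → Adj⁺ u v → Walk G⁺ (enc u) (enc v)
    walk⁺ u v p = step (Adj⁺⇒Adj u v p) here

    run-down : ∀ a b j → j ≤ M₀ → Walk G⁺ (enc (at a b j)) (enc (orig a))
    run-down a b zero le = walk⁺ (at a b 0) (orig a) (inj₁ (refl , refl))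
    run-down a b (suc j) le = walk-++ G⁺ (walk⁺ (at a b (suc j)) (at a b j) (at-down a b j le)) (run-down a b j (≤-trans (n≤1+n j) le))

    subdivided-edge : ∀ a b → SubEdge a b → Walk G⁺ (enc (orig b)) (enc (orig a))
    subdivided-edge a b ab = walk-++ G⁺ (walk⁺ (orig b) (at a b M₀) (at-last a b ab)) (run-down a b M₀ ≤-refl)

    edge⁺ : ∀ a b → Adj G a b → Walk G⁺ (enc (orig a)) (enc (orig b))
    edge⁺ a b ab with toℕ a <? toℕ b
    ... | yes a<b = walk-reverse G⁺ (subdivided-edge a b (a<b , ab))
    ... | no ¬a<b = subdivided-edge b a (subEdge-flip ab ¬a<b)

    lift-walk : ∀ {x y} → Walk G x y → Walk G⁺ (enc (orig x)) (enc (orig y))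
    lift-walk here = here
    lift-walk (step {x} {y} xy w) = walk-++ G⁺ (edge⁺ x y xy) (lift-walk w)

    root : V → Fin n
    root (orig a) = a
    root (mid a b t) = a

    to-root : ∀ u → Walk G⁺ (enc u) (enc (orig (root u)))
    to-root (orig a) = here
    to-root (mid a b t) = subst (λ s → Walk G⁺ (enc (mid a b s)) (enc (orig a))) (clamp-toℕ t)
                            (run-down a b (toℕ t) (toℕ≤M₀ t))

    connected⁺ : Connected G → Connected G⁺
    connected⁺ (0<n , walks) = ≤-trans 0<n (m≤m+n n _) , λ x y →
      subst₂ (Walk G⁺) (enc-dec x) (enc-dec y)
        (walk-++ G⁺ (to-root (dec x)) (walk-++ G⁺ (lift-walk (walks (root (dec x)) (root (dec y)))) (walk-reverse G⁺ (to-root (dec y)))))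

  -- A path
  -- of G⁺ is a path of G interleaved with runs, each lying in a single
  -- (a, b)-run, so it has at most (#originals)·(M + 1) + M vertices.
  module Projection where

    originals : List V → List (Fin n)
    originals [] = []
    originals (orig a ∷ xs) = a ∷ originals xs
    originals (mid _ _ _ ∷ xs) = originals xs

    originals-++ : ∀ xs ys → originals (xs ++ ys) ≡ originals xs ++ originals ys
    originals-++ [] ys = refl
    originals-++ (orig x ∷ xs) ys = cong (x ∷_) (originals-++ xs ys)
    originals-++ (mid _ _ _ ∷ xs) ys = originals-++ xs ys

    originals-reverse : ∀ xs → originals (reverse xs) ≡ reverse (originals xs)
    originals-reverse [] = refl
    originals-reverse (x ∷ xs) = begin
      originals (reverse (x ∷ xs))                ≡⟨ cong originals (unfold-reverse x xs) ⟩
      originals (reverse xs ++ [ x ])             ≡⟨ originals-++ (reverse xs) [ x ] ⟩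
      originals (reverse xs) ++ originals [ x ]   ≡⟨ cong (_++ originals [ x ]) (originals-reverse xs) ⟩
      reverse (originals xs) ++ originals [ x ]   ≡⟨ last-step x ⟩
      reverse (originals (x ∷ xs))                ∎
      where
      open ≡-Reasoning
      last-step : ∀ x → reverse (originals xs) ++ originals [ x ] ≡ reverse (originals (x ∷ xs))
      last-step (orig a) = sym (unfold-reverse a (originals xs))
      last-step (mid _ _ _) = ++-identityʳ _

    ∈originals⇒ : ∀ {a} xs → a ∈ originals xs → orig a ∈ xs
    ∈originals⇒ (orig x ∷ xs) (here refl) = here refl
    ∈originals⇒ (orig x ∷ xs) (there p) = there (∈originals⇒ xs p)
    ∈originals⇒ (mid _ _ _ ∷ xs) p = there (∈originals⇒ xs p)

    ⇒∈originals : ∀ {a} xs → orig a ∈ xs → a ∈ originals xs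
    ⇒∈originals (orig x ∷ xs) (here refl) = here refl
    ⇒∈originals (orig x ∷ xs) (there m) = there (⇒∈originals xs m)
    ⇒∈originals (mid _ _ _ ∷ xs) (there m) = ⇒∈originals xs m

    unique-originals : ∀ xs → Unique xs → Unique (originals xs)
    unique-originals [] _ = []
    unique-originals (orig x ∷ xs) (x∉ ∷ u) = tabulate (λ m e → lookup x∉ (∈originals⇒ xs m) (cong orig e)) ∷ unique-originals xs u
    unique-originals (mid _ _ _ ∷ xs) (_ ∷ u) = unique-originals xs u

    leadingRun : List V → List V
    leadingRun [] = []
    leadingRun (orig _ ∷ _) = []
    leadingRun (x@(mid _ _ _) ∷ xs) = x ∷ leadingRun xs

    leadingRun-⊆ : ∀ xs {v} → v ∈ leadingRun xs → v ∈ xs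
    leadingRun-⊆ (mid _ _ _ ∷ xs) (here refl) = here refl
    leadingRun-⊆ (mid _ _ _ ∷ xs) (there m) = there (leadingRun-⊆ xs m)

    unique-leadingRun : ∀ xs → Unique xs → Unique (leadingRun xs)
    unique-leadingRun [] _ = []
    unique-leadingRun (orig _ ∷ _) _ = []
    unique-leadingRun (mid _ _ _ ∷ xs) (x∉ ∷ u) = tabulate (λ m → lookup x∉ (leadingRun-⊆ xs m)) ∷ unique-leadingRun xs u

    leadingRun-within : ∀ a b t xs → Linked Adj⁺ (mid a b t ∷ xs) → ∀ {v} → v ∈ leadingRun (mid a b t ∷ xs) → v ∈ map (mid a b) (allFin M)
    leadingRun-within a b t xs l (here refl) = ∈-map⁺ (mid a b) (∈-allFin t)
    leadingRun-within a b t (mid a′ b′ t′ ∷ xs) ((refl , refl , _) ∷ l) (there m) = leadingRun-within a b t′ xs l m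

    leadingRun-length : ∀ xs → Unique xs → Linked Adj⁺ xs → length (leadingRun xs) ≤ M
    leadingRun-length [] _ _ = z≤n
    leadingRun-length (orig _ ∷ _) _ _ = z≤n
    leadingRun-length (mid a b t ∷ xs) u l = begin
      length (leadingRun (mid a b t ∷ xs)) ≤⟨ unique-length-≤ _ _ (unique-leadingRun _ u) (leadingRun-within a b t xs l) ⟩
      length (map (mid a b) (allFin M))     ≡⟨ trans (length-map (mid a b) (allFin M)) (length-tabulate {n = M} (λ i → i)) ⟩
      M                                      ∎
      where open ≤-Reasoning

    path-length-≤′ : ∀ xs → Unique xs → Linked Adj⁺ xs → length xs ≤ length (originals xs) * suc M + length (leadingRun xs)
    path-length-≤′ [] _ _ = z≤n
    path-length-≤′ (orig a ∷ xs) (_ ∷ u) l = s≤s (begin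
      length xs                                                ≤⟨ path-length-≤′ xs u (Linked.tail l) ⟩
      length (originals xs) * suc M + length (leadingRun xs)   ≤⟨ +-monoʳ-≤ (length (originals xs) * suc M) (leadingRun-length xs u (Linked.tail l)) ⟩
      length (originals xs) * suc M + M                        ≡⟨ +-comm _ M ⟩
      M + length (originals xs) * suc M                        ≡⟨ sym (+-identityʳ _) ⟩
      M + length (originals xs) * suc M + 0                    ∎)
      where open ≤-Reasoning
    path-length-≤′ (mid a b t ∷ xs) (_ ∷ u) l =
      ≤-trans (s≤s (path-length-≤′ xs u (Linked.tail l))) (≤-reflexive (sym (+-suc _ (length (leadingRun xs)))))

    path-length-≤ : ∀ xs → Unique xs → Linked Adj⁺ xs → length xs ≤ length (originals xs) * suc M + M
    path-length-≤ xs u l = ≤-trans (path-length-≤′ xs u l) (+-monoʳ-≤ _ (leadingRun-length xs u l))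

    EndOf : Fin n → Fin n → Fin n → Set
    EndOf o a b = (o ≡ a) ⊎ (SubEdge a b × (o ≡ b))

    attached-end : ∀ {o a b t} → Attached o a b t → EndOf o a b
    attached-end (inj₁ (e , _)) = inj₁ e
    attached-end (inj₂ (ab , e , _)) = inj₂ (ab , e)

    ends-adjacent : ∀ {o o′ a b} → EndOf o a b → EndOf o′ a b → o ≢ o′ → Adj G o o′
    ends-adjacent (inj₁ refl) (inj₁ refl) ne = ⊥-elim (ne refl)
    ends-adjacent (inj₁ refl) (inj₂ ((_ , ab) , refl)) ne = ab
    ends-adjacent (inj₂ ((_ , ab) , refl)) (inj₁ refl) ne = trans (Graph.sym G _ _) ab
    ends-adjacent (inj₂ (_ , refl)) (inj₂ (_ , refl)) ne = ⊥-elim (ne refl)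

    -- Leaving the run (a, b) entered from its end o, the next original
    -- vertex o′ is another end of the same run, hence a neighbour of o.
    exit-adjacent : ∀ {o o′ os} a b t R → EndOf o a b → Linked Adj⁺ (mid a b t ∷ R) → originals R ≡ o′ ∷ os → o ≢ o′ → Adj G o o′
    exit-adjacent a b t (orig x ∷ R) o-end (p ∷ _) refl ne = ends-adjacent o-end (attached-end p) ne
    exit-adjacent a b t (mid a′ b′ t′ ∷ R) o-end ((refl , refl , _) ∷ l) e ne = exit-adjacent a b t′ R o-end l e ne

    next-adjacent : ∀ o xs → All (orig o ≢_) xs → Linked Adj⁺ (orig o ∷ xs) → ∀ o′ os → originals xs ≡ o′ ∷ os → Adj G o o′
    next-adjacent o (mid a b t ∷ R) o∉ (p ∷ l) o′ os e = exit-adjacent a b t R (attached-end p) l e o≢o′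
      where
      o≢o′ : o ≢ o′
      o≢o′ refl = lookup o∉ (∈originals⇒ (mid a b t ∷ R) (subst (o ∈_) (sym e) (here refl))) refl

    linked-originals : ∀ xs → Unique xs → Linked Adj⁺ xs → Linked (Adj G) (originals xs)
    linked-originals [] _ _ = []
    linked-originals (mid _ _ _ ∷ xs) (_ ∷ u) l = linked-originals xs u (Linked.tail l)
    linked-originals (orig o ∷ xs) (o∉ ∷ u) l with originals xs in e | linked-originals xs u (Linked.tail l)
    ... | [] | _ = [-]
    ... | o′ ∷ os | l′ = next-adjacent o xs o∉ l o′ os e ∷ l′

  module Run (a b : Fin n) where
    open Projection

    up upFrom : ℕ → ℕ → List V
    up j k = at a b j ∷ upFrom j k
    upFrom j zero = []
    upFrom j (suc k) = up (suc j) k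

    down downFrom : ℕ → List V
    down j = at a b j ∷ downFrom j
    downFrom zero = []
    downFrom (suc j) = down j

    ascending descending : List V
    ascending = up 0 M₀
    descending = down M₀

    up-linked : ∀ j k ys → j + k ≤ M₀ → Linked Adj⁺ (at a b (j + k) ∷ ys) → Linked Adj⁺ (up j k ++ ys)
    up-linked j zero ys _ l = subst (λ i → Linked Adj⁺ (at a b i ∷ ys)) (+-identityʳ j) l
    up-linked j (suc k) ys le l =
      at-up a b j (≤-trans (s≤s (m≤m+n j k)) le′) ∷ up-linked (suc j) k ys le′ (subst (λ i → Linked Adj⁺ (at a b i ∷ ys)) (+-suc j k) l)
      where
      le′ : suc j + k ≤ M₀
      le′ = ≤-trans (≤-reflexive (sym (+-suc j k))) le

    down-linked : ∀ j ys → j ≤ M₀ → Linked Adj⁺ (at a b 0 ∷ ys) → Linked Adj⁺ (down j ++ ys)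
    down-linked zero ys _ l = l
    down-linked (suc j) ys le l = at-down a b j le ∷ down-linked j ys (≤-trans (n≤1+n j) le) l

    InRun : (ℕ → Set) → V → Set
    InRun Q v = ∃ λ t → (v ≡ mid a b t) × Q (toℕ t)

    at-in-run : ∀ {Q} j → j ≤ M₀ → Q j → InRun Q (at a b j)
    at-in-run {Q} j le q = clamp M₀ j , refl , subst Q (sym (toℕ-clamp M₀ j le)) q

    up-in-run : ∀ j k → j + k ≤ M₀ → All (InRun (j ≤_)) (up j k)
    up-in-run j zero le = at-in-run {j ≤_} j (≤-trans (m≤m+n j 0) le) ≤-refl ∷ []
    up-in-run j (suc k) le =
      at-in-run {j ≤_} j (≤-trans (m≤m+n j (suc k)) le) ≤-refl ∷
      All.map (λ { (t , e , q) → t , e , ≤-trans (n≤1+n j) q }) (up-in-run (suc j) k (≤-trans (≤-reflexive (sym (+-suc j k))) le))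

    down-in-run : ∀ j → j ≤ M₀ → All (InRun (_≤ j)) (down j)
    down-in-run zero le = at-in-run {_≤ 0} 0 le ≤-refl ∷ []
    down-in-run (suc j) le =
      at-in-run {_≤ suc j} (suc j) le ≤-refl ∷ All.map (λ { (t , e , q) → t , e , ≤-trans q (n≤1+n j) }) (down-in-run j (≤-trans (n≤1+n j) le))

    not-at : ∀ {Q} j {xs} → j ≤ M₀ → ¬ Q j → All (InRun Q) xs → All (at a b j ≢_) xs
    not-at {Q} j le ¬q = All.map λ { (t , refl , q) e → ¬q (subst Q (trans (cong toℕ (sym (proj₂ (proj₂ (mid-injective e))))) (toℕ-clamp M₀ j le)) q) }

    up-unique : ∀ j k → j + k ≤ M₀ → Unique (up j k)
    up-unique j zero le = [] ∷ []
    up-unique j (suc k) le = not-at {suc j ≤_} j (≤-trans (m≤m+n j (suc k)) le) 1+n≰n (up-in-run (suc j) k le′) ∷ up-unique (suc j) k le′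
      where
      le′ : suc j + k ≤ M₀
      le′ = ≤-trans (≤-reflexive (sym (+-suc j k))) le

    down-unique : ∀ j → j ≤ M₀ → Unique (down j)
    down-unique zero _ = [] ∷ []
    down-unique (suc j) le = not-at {_≤ j} (suc j) le 1+n≰n (down-in-run j (≤-trans (n≤1+n j) le)) ∷ down-unique j (≤-trans (n≤1+n j) le)

    ascending-sound : ∀ {v} → v ∈ ascending → ∃ λ t → v ≡ mid a b t
    ascending-sound v∈ with lookup (up-in-run 0 M₀ ≤-refl) v∈
    ... | t , e , _ = t , e

    descending-sound : ∀ {v} → v ∈ descending → ∃ λ t → v ≡ mid a b t
    descending-sound v∈ with lookup (down-in-run M₀ ≤-refl) v∈
    ... | t , e , _ = t , e

    up-complete : ∀ j k i → j ≤ i → i ≤ j + k → at a b i ∈ up j k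
    up-complete j k i j≤i i≤ with j ℕP.≟ i
    up-complete j k i j≤i i≤ | yes refl = here refl
    up-complete j zero i j≤i i≤ | no j≢i = ⊥-elim (j≢i (≤-antisym j≤i (≤-trans i≤ (≤-reflexive (+-identityʳ j)))))
    up-complete j (suc k) i j≤i i≤ | no j≢i = there (up-complete (suc j) k i (≤∧≢⇒< j≤i j≢i) (≤-trans i≤ (≤-reflexive (+-suc j k))))

    down-complete : ∀ j i → i ≤ j → at a b i ∈ down j
    down-complete j i i≤j with i ℕP.≟ j
    down-complete j i i≤j | yes refl = here refl
    down-complete zero i i≤j | no i≢j = ⊥-elim (i≢j (n≤0⇒n≡0 i≤j))
    down-complete (suc j) i i≤j | no i≢j = there (down-complete j i (≤-pred (≤∧≢⇒< i≤j i≢j)))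

    ascending-complete : ∀ t → mid a b t ∈ ascending
    ascending-complete t = subst (λ s → mid a b s ∈ ascending) (clamp-toℕ t) (up-complete 0 M₀ (toℕ t) z≤n (toℕ≤M₀ t))

    descending-complete : ∀ t → mid a b t ∈ descending
    descending-complete t = subst (λ s → mid a b s ∈ descending) (clamp-toℕ t) (down-complete M₀ (toℕ t) (toℕ≤M₀ t))

    up-originals : ∀ j k → originals (up j k) ≡ []
    up-originals j zero = refl
    up-originals j (suc k) = up-originals (suc j) k

    down-originals : ∀ j → originals (down j) ≡ []
    down-originals zero = refl
    down-originals (suc j) = down-originals j

    up-length : ∀ j k → length (up j k) ≡ suc k
    up-length j zero = refl
    up-length j (suc k) = cong suc (up-length (suc j) k)

    down-length : ∀ j → length (down j) ≡ suc j
    down-length zero = refl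
    down-length (suc j) = cong suc (down-length j)

  module Expansion where
    open Projection

    segment′ : ∀ p q → Dec (toℕ p < toℕ q) → List V
    segment′ p q (yes _) = Run.ascending p q
    segment′ p q (no _) = Run.descending q p

    segment : Fin n → Fin n → List V
    segment p q = segment′ p q (toℕ p <? toℕ q)

    trace legs : Fin n → List (Fin n) → List V
    trace p r = orig p ∷ legs p r
    legs p [] = []
    legs p (q ∷ r) = segment p q ++ trace q r

    lastOf : Fin n → List (Fin n) → Fin n
    lastOf p [] = p
    lastOf p (q ∷ r) = lastOf q r

    expand : Fin n → List (Fin n) → List V
    expand p r = Run.descending p p ++ trace p r ++ Run.ascending (lastOf p r) (lastOf p r)

    segment-linked : ∀ {p q} ys → Adj G p q → Linked Adj⁺ (orig q ∷ ys) → Linked Adj⁺ (orig p ∷ segment p q ++ orig q ∷ ys)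
    segment-linked {p} {q} ys pq l with toℕ p <? toℕ q
    ... | yes p<q = inj₁ (refl , refl) ∷ Run.up-linked p q 0 M₀ (orig q ∷ ys) ≤-refl (Adj⁺-sym (orig q) (at p q M₀) (at-last p q (p<q , pq)) ∷ l)
    ... | no ¬p<q = at-last q p (subEdge-flip pq ¬p<q) ∷ Run.down-linked q p M₀ (orig q ∷ ys) ≤-refl (inj₁ (refl , refl) ∷ l)

    trace-linked : ∀ p r ys → Linked (Adj G) (p ∷ r) → Linked Adj⁺ (orig (lastOf p r) ∷ ys) → Linked Adj⁺ (trace p r ++ ys)
    trace-linked p [] ys _ l = l
    trace-linked p (q ∷ r) ys (pq ∷ lr) l =
      subst (λ zs → Linked Adj⁺ (orig p ∷ zs)) (sym (++-assoc (segment p q) (trace q r) ys))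
            (segment-linked (legs q r ++ ys) pq (trace-linked q r ys lr l))

    expand-linked : ∀ p r → Linked (Adj G) (p ∷ r) → Linked Adj⁺ (expand p r)
    expand-linked p r lr = Run.down-linked p p M₀ _ ≤-refl (inj₁ (refl , refl) ∷ trace-linked p r _ lr pendant)
      where
      e = lastOf p r
      pendant : Linked Adj⁺ (orig e ∷ Run.ascending e e)
      pendant = inj₁ (refl , refl) ∷ subst (Linked Adj⁺) (++-identityʳ _) (Run.up-linked e e 0 M₀ [] ≤-refl [-])

    OnSegment : Fin n → Fin n → V → Set
    OnSegment p q v = ∃ λ t → ((v ≡ mid p q t) × (toℕ p < toℕ q)) ⊎ ((v ≡ mid q p t) × (toℕ q < toℕ p))

    segment-sound : ∀ {p q} → Adj G p q → ∀ {v} → v ∈ segment p q → OnSegment p q v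
    segment-sound {p} {q} pq v∈ with toℕ p <? toℕ q
    ... | yes p<q = let (t , e) = Run.ascending-sound p q v∈ in t , inj₁ (e , p<q)
    ... | no ¬p<q = let (t , e) = Run.descending-sound q p v∈ in t , inj₂ (e , proj₁ (subEdge-flip pq ¬p<q))

    OnTrace : List (Fin n) → V → Set
    OnTrace P v = (∃ λ x → (v ≡ orig x) × (x ∈ P))
                ⊎ (∃ λ a → ∃ λ b → ∃ λ t → (v ≡ mid a b t) × (toℕ a < toℕ b) × (a ∈ P) × (b ∈ P))

    trace-sound : ∀ p r → Linked (Adj G) (p ∷ r) → ∀ {v} → v ∈ trace p r → OnTrace (p ∷ r) v
    trace-sound p r _ (here e) = inj₁ (p , e , here refl)
    trace-sound p (q ∷ r) (pq ∷ lr) (there v∈) with ∈-++⁻ (segment p q) v∈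
    ... | inj₁ s with segment-sound pq s
    ...   | t , inj₁ (e , p<q) = inj₂ (p , q , t , e , p<q , here refl , there (here refl))
    ...   | t , inj₂ (e , q<p) = inj₂ (q , p , t , e , q<p , there (here refl) , here refl)
    trace-sound p (q ∷ r) (pq ∷ lr) (there v∈) | inj₂ s with trace-sound q r lr s
    ...   | inj₁ (x , e , m) = inj₁ (x , e , there m)
    ...   | inj₂ (a , b , t , e , a<b , ma , mb) = inj₂ (a , b , t , e , a<b , there ma , there mb)

    -- A pendant run (a, a) never meets a trace, whose runs have a < b.
    pendant-off-trace : ∀ {P a t} → ¬ OnTrace P (mid a a t)
    pendant-off-trace (inj₁ (_ , () , _))
    pendant-off-trace (inj₂ (_ , _ , _ , refl , a<a , _)) = <-irrefl refl a<a

    segment-unique : ∀ p q → Unique (segment p q)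
    segment-unique p q with toℕ p <? toℕ q
    ... | yes _ = Run.up-unique p q 0 M₀ ≤-refl
    ... | no _ = Run.down-unique q p M₀ ≤-refl

    trace-unique : ∀ p r → Unique (p ∷ r) → Linked (Adj G) (p ∷ r) → Unique (trace p r)
    trace-unique p [] _ _ = [] ∷ []
    trace-unique p (q ∷ r) (p∉ ∷ ur) (pq ∷ lr) =
      tabulate head-fresh ∷ UniqueP.++⁺ (segment-unique p q) (trace-unique q r ur lr) disjoint
      where
      head-fresh : ∀ {v} → v ∈ segment p q ++ trace q r → orig p ≢ v
      head-fresh v∈ refl with ∈-++⁻ (segment p q) v∈
      ... | inj₁ s with segment-sound pq s
      ...   | _ , inj₁ (() , _)
      ...   | _ , inj₂ (() , _)
      head-fresh v∈ refl | inj₂ s with trace-sound q r lr s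
      ...   | inj₁ (x , refl , m) = lookup p∉ m refl
      ...   | inj₂ (_ , _ , _ , () , _)
      disjoint : ∀ {v} → ¬ (v ∈ segment p q × v ∈ trace q r)
      disjoint (s , x) with segment-sound pq s | trace-sound q r lr x
      ... | _ , inj₁ (refl , _) | inj₁ (_ , () , _)
      ... | _ , inj₂ (refl , _) | inj₁ (_ , () , _)
      ... | _ , inj₁ (refl , _) | inj₂ (_ , _ , _ , refl , _ , p∈ , _) = lookup p∉ p∈ refl
      ... | _ , inj₂ (refl , _) | inj₂ (_ , _ , _ , refl , _ , _ , p∈) = lookup p∉ p∈ refl

    lastOf∈ : ∀ p r → lastOf p r ∈ p ∷ r
    lastOf∈ p [] = here refl
    lastOf∈ p (q ∷ r) = there (lastOf∈ q r)

    -- The two pendant runs are distinct since a path with an edge has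
    -- distinct ends.
    expand-unique : ∀ p r → r ≢ [] → Unique (p ∷ r) → Linked (Adj G) (p ∷ r) → Unique (expand p r)
    expand-unique p r r≢[] u l =
      UniqueP.++⁺ (Run.down-unique p p M₀ ≤-refl) (UniqueP.++⁺ (trace-unique p r u l) (Run.up-unique e e 0 M₀ ≤-refl) end-disjoint) start-disjoint
      where
      e = lastOf p r
      p≢e : p ≢ e
      p≢e = first≢last r r≢[] u
        where
        first≢last : ∀ r → r ≢ [] → Unique (p ∷ r) → p ≢ lastOf p r
        first≢last [] r≢[] _ = ⊥-elim (r≢[] refl)
        first≢last (q ∷ r′) _ (p∉ ∷ _) = lookup p∉ (lastOf∈ q r′)
      end-disjoint : ∀ {v} → ¬ (v ∈ trace p r × v ∈ Run.ascending e e)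
      end-disjoint (x , y) with Run.ascending-sound e e y
      ... | _ , refl = pendant-off-trace (trace-sound p r l x)
      start-disjoint : ∀ {v} → ¬ (v ∈ Run.descending p p × v ∈ trace p r ++ Run.ascending e e)
      start-disjoint (x , y) with Run.descending-sound p p x | ∈-++⁻ (trace p r) y
      ... | _ , refl | inj₁ z = pendant-off-trace (trace-sound p r l z)
      ... | _ , refl | inj₂ z with Run.ascending-sound e e z
      ...   | _ , e′ = p≢e (proj₁ (mid-injective e′))

    segment-originals : ∀ p q → originals (segment p q) ≡ []
    segment-originals p q with toℕ p <? toℕ q
    ... | yes _ = Run.up-originals p q 0 M₀
    ... | no _ = Run.down-originals q p M₀

    trace-originals : ∀ p r → originals (trace p r) ≡ p ∷ r
    trace-originals p [] = refl
    trace-originals p (q ∷ r) = cong (p ∷_) (begin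
      originals (segment p q ++ trace q r)        ≡⟨ originals-++ (segment p q) (trace q r) ⟩
      originals (segment p q) ++ originals (trace q r) ≡⟨ cong₂ _++_ (segment-originals p q) (trace-originals q r) ⟩
      q ∷ r                                        ∎)
      where open ≡-Reasoning

    expand-originals : ∀ p r → originals (expand p r) ≡ p ∷ r
    expand-originals p r = begin
      originals (expand p r)                                         ≡⟨ originals-++ (Run.descending p p) _ ⟩
      originals (Run.descending p p) ++ originals (trace p r ++ asc) ≡⟨ cong₂ _++_ (Run.down-originals p p M₀) (originals-++ (trace p r) asc) ⟩
      originals (trace p r) ++ originals asc                          ≡⟨ cong₂ _++_ (trace-originals p r) (Run.up-originals e e 0 M₀) ⟩
      (p ∷ r) ++ []                                                   ≡⟨ ++-identityʳ (p ∷ r) ⟩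
      p ∷ r                                                           ∎
      where
      open ≡-Reasoning
      e = lastOf p r
      asc = Run.ascending e e

    segment-length : ∀ p q → length (segment p q) ≡ M
    segment-length p q with toℕ p <? toℕ q
    ... | yes _ = Run.up-length p q 0 M₀
    ... | no _ = Run.down-length q p M₀

    trace-length : ∀ p r → length (trace p r) ≡ suc (length r * suc M)
    trace-length p [] = refl
    trace-length p (q ∷ r) = cong suc (begin
      length (segment p q ++ trace q r)            ≡⟨ length-++ (segment p q) ⟩
      length (segment p q) + length (trace q r)    ≡⟨ cong₂ _+_ (segment-length p q) (trace-length q r) ⟩
      M + suc (length r * suc M)                   ≡⟨ +-suc M _ ⟩
      suc M + length r * suc M                     ∎)
      where open ≡-Reasoning

    expand-length : ∀ p r → length (expand p r) ≡ M + (suc (length r * suc M) + M)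
    expand-length p r = begin
      length (expand p r)                                              ≡⟨ length-++ (Run.descending p p) ⟩
      length (Run.descending p p) + length (trace p r ++ asc)          ≡⟨ cong₂ _+_ (Run.down-length p p M₀) (length-++ (trace p r)) ⟩
      M + (length (trace p r) + length asc)                             ≡⟨ cong (M +_) (cong₂ _+_ (trace-length p r) (Run.up-length e e 0 M₀)) ⟩
      M + (suc (length r * suc M) + M)                                  ∎
      where
      open ≡-Reasoning
      e = lastOf p r
      asc = Run.ascending e e

    ClosedIn : List V → List V → Set
    ClosedIn X Y = ∀ a b t → mid a b t ∈ X → (∀ t′ → mid a b t′ ∈ Y) × (orig a ∈ Y) × (orig b ∈ Y)

    segment-closed : ∀ {p q} → Adj G p q → ∀ {a b t} → mid a b t ∈ segment p q →
                     (∀ t′ → mid a b t′ ∈ segment p q) × (((a ≡ p) × (b ≡ q)) ⊎ ((a ≡ q) × (b ≡ p)))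
    segment-closed {p} {q} pq m with toℕ p <? toℕ q
    ... | yes _ with Run.ascending-sound p q m
    ...   | _ , refl = Run.ascending-complete p q , inj₁ (refl , refl)
    segment-closed {p} {q} pq m | no _ with Run.descending-sound q p m
    ...   | _ , refl = Run.descending-complete q p , inj₂ (refl , refl)

    trace-closed : ∀ p r Y → Linked (Adj G) (p ∷ r) → (∀ {v} → v ∈ trace p r → v ∈ Y) → ClosedIn (trace p r) Y
    trace-closed p (q ∷ r) Y (pq ∷ lr) sub a b t (there m) with ∈-++⁻ (segment p q) m
    ... | inj₂ m′ = trace-closed q r Y lr (λ z → sub (there (∈-++⁺ʳ (segment p q) z))) a b t m′
    ... | inj₁ m′ with segment-closed pq m′
    ...   | whole , inj₁ (refl , refl) = (λ t′ → sub (there (∈-++⁺ˡ (whole t′)))) , sub (here refl) , sub (there (∈-++⁺ʳ (segment p q) (here refl)))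
    ...   | whole , inj₂ (refl , refl) = (λ t′ → sub (there (∈-++⁺ˡ (whole t′)))) , sub (there (∈-++⁺ʳ (segment p q) (here refl))) , sub (here refl)

    expand-closed : ∀ p r → Linked (Adj G) (p ∷ r) → ClosedIn (expand p r) (expand p r)
    expand-closed p r l a b t m with ∈-++⁻ (Run.descending p p) m
    ... | inj₁ m′ with Run.descending-sound p p m′
    ...   | _ , refl = (λ t′ → ∈-++⁺ˡ (Run.descending-complete p p t′)) , p∈ , p∈
      where p∈ = ∈-++⁺ʳ (Run.descending p p) (here refl)
    expand-closed p r l a b t m | inj₂ m′ with ∈-++⁻ (trace p r) m′
    ... | inj₁ m″ = trace-closed p r (expand p r) l (λ z → ∈-++⁺ʳ (Run.descending p p) (∈-++⁺ˡ z)) a b t m″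
    ... | inj₂ m″ with Run.ascending-sound (lastOf p r) (lastOf p r) m″
    ...   | _ , refl = (λ t′ → ∈-++⁺ʳ (Run.descending p p) (∈-++⁺ʳ (trace p r) (Run.ascending-complete e e t′))) , e∈ , e∈
      where
      e = lastOf p r
      e∈ = ∈-++⁺ʳ (Run.descending p p) (∈-++⁺ˡ (∈originals⇒ (trace p r) (subst (e ∈_) (sym (trace-originals p r)) (lastOf∈ p r))))

  -- Each vertex of G⁺ has an anchor: an original vertex within distance
  -- < h of it along its own run (new vertices in the upper half of a
  -- subdividing run are anchored at the far end).
  anchor′ : ∀ a b (t : Fin M) → Dec (SubEdge a b) → Dec (toℕ t < h) → Fin n
  anchor′ a b t (yes _) (no _) = b
  anchor′ a b t _ _ = a

  anchor : V → Fin n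
  anchor (orig c) = c
  anchor (mid a b t) = anchor′ a b t (SubEdge? a b) (toℕ t <? h)

  -- For a closed vertex set X, ψ is a truncated "distance to X": it
  -- vanishes on X, changes by at most 1 along edges of G⁺, and is at least
  -- h at every vertex whose anchor is not in X.
  module Potential (X : List V) (closed : Expansion.ClosedIn X X) where
    open import Data.List.Membership.DecPropositional _≟V_ using (_∈?_)

    unless : ∀ {P : Set} → Dec P → ℕ → ℕ
    unless (yes _) _ = 0
    unless (no _) k = k

    unless-yes : ∀ {P : Set} (d : Dec P) k → P → unless d k ≡ 0
    unless-yes (yes _) k _ = refl
    unless-yes (no ¬p) k p = ⊥-elim (¬p p)

    unless-no : ∀ {P : Set} (d : Dec P) k → ¬ P → unless d k ≡ k
    unless-no (yes p) k ¬p = ⊥-elim (¬p p)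
    unless-no (no _) k _ = refl

    unless-≤ : ∀ {P : Set} (d : Dec P) k → unless d k ≤ k
    unless-≤ (yes _) k = z≤n
    unless-≤ (no _) k = ≤-refl

    ψorig : Fin n → ℕ
    ψorig c = unless (orig c ∈? X) h

    -- the value seen from the far end of the run (a, b), if it is attached
    ψfar′ : ∀ a b → Dec (SubEdge a b) → ℕ
    ψfar′ a b (yes _) = ψorig b
    ψfar′ a b (no _) = h

    ψfar : Fin n → Fin n → ℕ
    ψfar a b = ψfar′ a b (SubEdge? a b)

    ψmid : Fin n → Fin n → Fin M → ℕ
    ψmid a b t = h ⊓ (ψorig a + suc (toℕ t)) ⊓ (ψfar a b + (M ∸ toℕ t))

    ψ : V → ℕ
    ψ (orig c) = ψorig c
    ψ (mid a b t) = unless (mid a b t ∈? X) (ψmid a b t)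

    ψorig-≤ : ∀ c → ψorig c ≤ h
    ψorig-≤ c = unless-≤ (orig c ∈? X) h

    ψ-vanishes : ∀ v → v ∈ X → ψ v ≡ 0
    ψ-vanishes (orig c) m = unless-yes (orig c ∈? X) h m
    ψ-vanishes (mid a b t) m = unless-yes (mid a b t ∈? X) _ m

    h≤M : h ≤ M
    h≤M = m≤m+n h h

    ψmid-≥-start : ∀ a b t → toℕ t ≡ 0 → ψorig a ≤ ψmid a b t
    ψmid-≥-start a b t t≡0 =
      ⊓-glb (⊓-glb (ψorig-≤ a) (m≤m+n (ψorig a) _))
            (≤-trans (ψorig-≤ a) (≤-trans h≤M (≤-trans (≤-reflexive (cong (M ∸_) (sym t≡0))) (m≤n+m _ _))))

    ψmid-≥-end : ∀ a b t → SubEdge a b → suc (toℕ t) ≡ M → ψorig b ≤ ψmid a b t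
    ψmid-≥-end a b t ab last with SubEdge? a b
    ... | no ¬ab = ⊥-elim (¬ab ab)
    ... | yes _ = ⊓-glb (⊓-glb (ψorig-≤ b) (≤-trans (ψorig-≤ b) (≤-trans h≤M (≤-trans (≤-reflexive (sym last)) (m≤n+m _ _))))) (m≤m+n (ψorig b) _)

    ψmid-≤-start : ∀ a b t → ψmid a b t ≤ ψorig a + suc (toℕ t)
    ψmid-≤-start a b t = ≤-trans (m⊓n≤m _ _) (m⊓n≤n _ _)

    ψmid-≤-end : ∀ a b t → SubEdge a b → suc (toℕ t) ≡ M → ψmid a b t ≤ suc (ψorig b)
    ψmid-≤-end a b t ab last with SubEdge? a b
    ... | no ¬ab = ⊥-elim (¬ab ab)
    ... | yes _ = ≤-trans (m⊓n≤n _ _) (≤-reflexive (begin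
        ψorig b + (M ∸ toℕ t)          ≡⟨ cong (λ m → ψorig b + (m ∸ toℕ t)) (sym last) ⟩
        ψorig b + (suc (toℕ t) ∸ toℕ t) ≡⟨ cong (ψorig b +_) (m+n∸n≡m 1 (toℕ t)) ⟩
        ψorig b + 1                     ≡⟨ +-comm (ψorig b) 1 ⟩
        suc (ψorig b)                   ∎))
      where open ≡-Reasoning

    ∸-step : ∀ m t → m ∸ t ≤ suc (m ∸ suc t)
    ∸-step zero zero = z≤n
    ∸-step zero (suc t) = z≤n
    ∸-step (suc m) zero = ≤-refl
    ∸-step (suc m) (suc t) = ∸-step m t

    ψmid-lipschitz : ∀ a b t t′ → Consecutive t t′ → ψmid a b t ≤ suc (ψmid a b t′)
    ψmid-lipschitz a b t t′ st = ⊓-mono-≤ (⊓-mono-≤ (n≤1+n h) (from-start st)) (from-end st)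
      where
      from-start : Consecutive t t′ → ψorig a + suc (toℕ t) ≤ suc (ψorig a + suc (toℕ t′))
      from-start (inj₁ e) = ≤-trans (+-monoʳ-≤ (ψorig a) (≤-trans (≤-reflexive e) (≤-trans (n≤1+n _) (n≤1+n _)))) (≤-reflexive (+-suc (ψorig a) (suc (toℕ t′))))
      from-start (inj₂ e) = ≤-trans (+-monoʳ-≤ (ψorig a) (≤-reflexive (cong suc (sym e)))) (≤-reflexive (+-suc (ψorig a) (suc (toℕ t′))))
      from-end : Consecutive t t′ → ψfar a b + (M ∸ toℕ t) ≤ suc (ψfar a b + (M ∸ toℕ t′))
      from-end (inj₁ e) = ≤-trans (+-monoʳ-≤ _ (≤-trans (∸-step M (toℕ t)) (≤-reflexive (cong (λ z → suc (M ∸ z)) e)))) (≤-reflexive (+-suc _ _))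
      from-end (inj₂ e) = ≤-trans (+-monoʳ-≤ _ (≤-trans (≤-reflexive (cong (M ∸_) (sym e))) (≤-trans (∸-monoʳ-≤ M (n≤1+n (toℕ t′))) (n≤1+n _)))) (≤-reflexive (+-suc _ _))

    attached-in-X : ∀ {o a b t} → Attached o a b t → orig a ∈ X → orig b ∈ X → orig o ∈ X
    attached-in-X (inj₁ (refl , _)) a∈ b∈ = a∈
    attached-in-X (inj₂ (_ , refl , _)) a∈ b∈ = b∈

    ψ-lipschitz : ∀ x y → Adj⁺ x y → ψ x ≤ suc (ψ y)
    ψ-lipschitz (orig o) (mid a b t) att with mid a b t ∈? X
    ... | yes m = let (_ , a∈ , b∈) = closed a b t m in ≤-trans (≤-reflexive (unless-yes (orig o ∈? X) h (attached-in-X att a∈ b∈))) z≤n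
    ... | no _ with att
    ...   | inj₁ (refl , t≡0) = ≤-trans (ψmid-≥-start a b t t≡0) (n≤1+n _)
    ...   | inj₂ (ab , refl , last) = ≤-trans (ψmid-≥-end a b t ab last) (n≤1+n _)
    ψ-lipschitz (mid a b t) (orig o) att with mid a b t ∈? X
    ... | yes m = z≤n
    ... | no _ with att
    ...   | inj₁ (refl , t≡0) = ≤-trans (ψmid-≤-start a b t) (≤-reflexive (trans (cong (λ z → ψorig a + suc z) t≡0) (+-comm (ψorig a) 1)))
    ...   | inj₂ (ab , refl , last) = ψmid-≤-end a b t ab last
    ψ-lipschitz (mid a b t) (mid a b t′) (refl , refl , st) with mid a b t ∈? X | mid a b t′ ∈? X
    ... | yes _ | _ = z≤n
    ... | no t∉ | yes t′∈ = ⊥-elim (t∉ (proj₁ (closed a b t′ t′∈) t))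
    ... | no _ | no _ = ψmid-lipschitz a b t t′ st

    ψ-near-start : ∀ a b t → orig a ∉ X → (toℕ t < h) ⊎ (¬ SubEdge a b) → h ≤ ψ (mid a b t)
    ψ-near-start a b t a∉ cond with mid a b t ∈? X
    ... | yes m = ⊥-elim (a∉ (proj₁ (proj₂ (closed a b t m))))
    ... | no _ = ⊓-glb (⊓-glb ≤-refl (≤-trans (≤-reflexive (sym (unless-no (orig a ∈? X) h a∉))) (m≤m+n _ _))) (from-end (SubEdge? a b) cond)
      where
      from-end : ∀ d → (toℕ t < h) ⊎ (¬ SubEdge a b) → h ≤ ψfar′ a b d + (M ∸ toℕ t)
      from-end (no _) _ = m≤m+n h _
      from-end (yes ab) (inj₂ ¬ab) = ⊥-elim (¬ab ab)
      from-end (yes _) (inj₁ t<h) = ≤-trans (≤-trans (≤-reflexive (sym (m+n∸n≡m h h))) (∸-monoʳ-≤ M (<⇒≤ t<h))) (m≤n+m _ _)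

    ψ-near-end : ∀ a b t → orig b ∉ X → SubEdge a b → h ≤ toℕ t → h ≤ ψ (mid a b t)
    ψ-near-end a b t b∉ ab h≤t with mid a b t ∈? X
    ... | yes m = ⊥-elim (b∉ (proj₂ (proj₂ (closed a b t m))))
    ... | no _ = ⊓-glb (⊓-glb ≤-refl (≤-trans h≤t (≤-trans (n≤1+n _) (m≤n+m _ _)))) (from-end (SubEdge? a b))
      where
      from-end : ∀ d → h ≤ ψfar′ a b d + (M ∸ toℕ t)
      from-end (no ¬ab) = ⊥-elim (¬ab ab)
      from-end (yes _) = ≤-trans (≤-reflexive (sym (unless-no (orig b ∈? X) h b∉))) (m≤m+n _ _)

    ψ-≥-off-anchor : ∀ u → orig (anchor u) ∉ X → h ≤ ψ u
    ψ-≥-off-anchor (orig c) c∉ = ≤-reflexive (sym (unless-no (orig c ∈? X) h c∉))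
    ψ-≥-off-anchor (mid a b t) = by-anchor (SubEdge? a b) (toℕ t <? h)
      where
      by-anchor : ∀ d d′ → orig (anchor′ a b t d d′) ∉ X → h ≤ ψ (mid a b t)
      by-anchor (yes ab) (no t≮h) b∉ = ψ-near-end a b t b∉ ab (≮⇒≥ t≮h)
      by-anchor (yes _) (yes t<h) a∉ = ψ-near-start a b t a∉ (inj₁ t<h)
      by-anchor (no ¬ab) _ a∉ = ψ-near-start a b t a∉ (inj₂ ¬ab)

  module Lifting where
    open Projection
    open Expansion

    lift : List (Fin n) → List (Fin N)
    lift [] = []
    lift (p ∷ r) = map enc (expand p r)

    decode : List (Fin N) → List (Fin n)
    decode xs = originals (map dec xs)

    decode-lift : ∀ P → decode (lift P) ≡ P
    decode-lift [] = refl
    decode-lift (p ∷ r) = begin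
      originals (map dec (map enc (expand p r))) ≡⟨ cong originals (sym (map-∘ {g = dec} {f = enc} (expand p r))) ⟩
      originals (map (dec ∘′ enc) (expand p r))  ≡⟨ cong originals (trans (map-cong dec-enc (expand p r)) (map-id (expand p r))) ⟩
      originals (expand p r)                     ≡⟨ expand-originals p r ⟩
      p ∷ r                                      ∎
      where open ≡-Reasoning

    decode-reverse : ∀ xs → decode (reverse xs) ≡ reverse (decode xs)
    decode-reverse xs = trans (cong originals (reverse-map dec xs)) (originals-reverse (map dec xs))

    lift-reflects-SamePath : ∀ P Q → SamePath (lift P) (lift Q) → SamePath P Q
    lift-reflects-SamePath P Q (inj₁ e) = inj₁ (begin
      P                ≡⟨ sym (decode-lift P) ⟩
      decode (lift P)  ≡⟨ cong decode e ⟩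
      decode (lift Q)  ≡⟨ decode-lift Q ⟩
      Q                ∎)
      where open ≡-Reasoning
    lift-reflects-SamePath P Q (inj₂ e) = inj₂ (begin
      P                          ≡⟨ sym (decode-lift P) ⟩
      decode (lift P)            ≡⟨ cong decode e ⟩
      decode (reverse (lift Q))  ≡⟨ decode-reverse (lift Q) ⟩
      reverse (decode (lift Q))  ≡⟨ cong reverse (decode-lift Q) ⟩
      reverse Q                  ∎)
      where open ≡-Reasoning

    -- A path of G⁺ decodes to a path of G (or to nothing), so it has at most
    -- (l + 1)(M + 1) + M vertices where l + 1 bounds paths of G.
    path⁺-length : ∀ Q → IsPath G⁺ Q → ∀ L → (∀ R → IsPath G R → length R ≤ suc L) → length Q ≤ suc L * suc M + M
    path⁺-length Q (_ , uQ , lQ) L longest = begin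
      length Q                                  ≡⟨ sym (length-map dec Q) ⟩
      length (map dec Q)                        ≤⟨ path-length-≤ (map dec Q) uQ′ lQ′ ⟩
      length (decode Q) * suc M + M             ≤⟨ +-monoˡ-≤ M (*-monoˡ-≤ (suc M) decoded-bound) ⟩
      suc L * suc M + M                         ∎
      where
      open ≤-Reasoning
      uQ′ : Unique (map dec Q)
      uQ′ = UniqueP.map⁺ dec-injective uQ
      lQ′ : Linked Adj⁺ (map dec Q)
      lQ′ = LinkedP.map⁺ (Linked.map (λ {x} {y} → Adj⇒Adj⁺ x y) lQ)
      decoded-bound : length (decode Q) ≤ suc L
      decoded-bound with decode Q in e
      ... | [] = z≤n
      ... | o ∷ os = longest (o ∷ os) ((λ ()) , subst Unique e (unique-originals _ uQ′) , subst (Linked (Adj G)) e (linked-originals _ uQ′ lQ′))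

    lift-longest : ∀ P → IsLongest G P → 2 ≤ length P → IsLongest G⁺ (lift P)
    lift-longest [] ((ne , _) , _) _ = ⊥-elim (ne refl)
    lift-longest (p ∷ []) _ (s≤s ())
    lift-longest (p ∷ r@(_ ∷ _)) ((_ , u , l) , longest) _ = ((λ ()) , unique⁺ , linked⁺) , bound
      where
      unique⁺ : Unique (lift (p ∷ r))
      unique⁺ = UniqueP.map⁺ enc-injective (expand-unique p r (λ ()) u l)
      linked⁺ : Linked (Adj G⁺) (lift (p ∷ r))
      linked⁺ = LinkedP.map⁺ (Linked.map (λ {x} {y} → Adj⁺⇒Adj x y) (expand-linked p r l))
      bound : ∀ Q → IsPath G⁺ Q → length Q ≤ length (lift (p ∷ r))
      bound Q pQ = begin
        length Q                              ≤⟨ path⁺-length Q pQ (length r) longest ⟩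
        suc (length r) * suc M + M            ≡⟨ cong (_+ M) (sym (+-suc M (length r * suc M))) ⟩
        M + suc (length r * suc M) + M        ≡⟨ +-assoc M (suc (length r * suc M)) M ⟩
        M + (suc (length r * suc M) + M)      ≡⟨ sym (trans (length-map enc (expand p r)) (expand-length p r)) ⟩
        length (lift (p ∷ r))                 ∎
        where open ≤-Reasoning

    lift-far : 0 < n → ∀ P → IsPath G P → ∀ x → anchor (dec x) ∉ P → h ≤ dist G⁺ x (lift P)
    lift-far 0<n [] (ne , _) = ⊥-elim (ne refl)
    lift-far 0<n (p ∷ r) (_ , _ , l) x anchor∉ =
      DistanceLowerBound.dist-≥ G⁺ (ψ ∘′ dec) (λ y z yz → ψ-lipschitz (dec y) (dec z) (Adj⇒Adj⁺ y z yz))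
        (lift (p ∷ r)) x h vanishes (ψ-≥-off-anchor (dec x) (λ m → anchor∉ (on-path m))) (h≤N 0<n)
      where
      open Potential (expand p r) (expand-closed p r l)
      vanishes : ∀ u → u ∈ lift (p ∷ r) → ψ (dec u) ≡ 0
      vanishes u m with ∈-map⁻ enc m
      ... | v , v∈ , refl = trans (cong ψ (dec-enc v)) (ψ-vanishes v v∈)
      on-path : ∀ {c} → orig c ∈ expand p r → c ∈ p ∷ r
      on-path m = subst (_ ∈_) (expand-originals p r) (⇒∈originals (expand p r) m)

    lift-ThreeLongest : ∀ {P₁ P₂ P₃} → ThreeLongest G P₁ P₂ P₃ → ThreeLongest G⁺ (lift P₁) (lift P₂) (lift P₃)
    lift-ThreeLongest {P₁} {P₂} {P₃} (conn , L₁ , L₂ , L₃ , d₁₂ , d₁₃ , d₂₃) =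
      Connectivity.connected⁺ conn ,
      lift-longest P₁ L₁ (nontrivial L₁) , lift-longest P₂ L₂ (nontrivial L₂) , lift-longest P₃ L₃ (nontrivial L₃) ,
      distinct d₁₂ , distinct d₁₃ , distinct d₂₃
      where
      two-vertices = distinct-vertices G P₁ P₂ (proj₁ L₁) (proj₁ L₂) (λ e → d₁₂ (inj₁ e))
      nontrivial : ∀ {P} → IsLongest G P → 2 ≤ length P
      nontrivial L = longest-nontrivial G conn L (proj₂ (proj₂ two-vertices))
      distinct : ∀ {P Q} → ¬ SamePath P Q → ¬ SamePath (lift P) (lift Q)
      distinct ¬same same = ¬same (lift-reflects-SamePath _ _ same)

    f-lift-≥ : 0 < n → ∀ Ps → All (IsPath G) Ps → (∀ v → Any (v ∉_) Ps) → h ≤ f G⁺ (map lift Ps)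
    f-lift-≥ 0<n Ps paths missed = minimum-glb h (map F (allFin N)) (tabulate bound) (map-allFin-nonempty F (≤-trans (s≤s z≤n) (h≤N 0<n)))
      where
      F : Fin N → ℕ
      F x = sum (map (dist G⁺ x) (map lift Ps))
      bound : ∀ {y} → y ∈ map F (allFin N) → h ≤ y
      bound m with ∈-map⁻ F m
      ... | x , _ , refl with find (missed (anchor (dec x)))
      ... | P , P∈ , anchor∉ = ≤-trans (lift-far 0<n P (lookup paths P∈) x anchor∉) (∈⇒≤sum (∈-map⁺ (dist G⁺ x) (∈-map⁺ lift P∈)))

module _ {n : ℕ} where
  open import Data.List.Membership.DecPropositional (_≟_ {n}) using (_∈?_)

  common-or-missed : ∀ (Ps : List (List (Fin n))) → (∃ λ v → All (v ∈_) Ps) ⊎ (∀ v → Any (v ∉_) Ps)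
  common-or-missed Ps with any? (λ v → All.all? (v ∈?_) Ps)
  ... | yes common = inj₁ common
  ... | no none = inj₂ λ v → ¬All⇒Any¬ (v ∈?_) Ps (λ v∈Ps → none (v , v∈Ps))

blowup-order-< : ∀ n h → n < h → n + n * (n * (h + h)) < suc (n * (n * 2)) * h
blowup-order-< n h n<h = ≤-trans (+-monoˡ-≤ (n * (n * (h + h))) n<h) (≤-reflexive (cong (h +_) (identity n h)))
  where
  identity : ∀ n h → n * (n * (h + h)) ≡ n * (n * 2) * h
  identity = solve-∀

A⇒B : StatementA → StatementB
A⇒B A = (λ _ → 0) , (λ _ _ _ → z≤n) , (λ k → 0 , λ _ _ → ≤-trans (≤-reflexive (*-zeroʳ k)) z≤n) ,
        λ n G P₁ P₂ P₃ T → ≤-reflexive (A n G P₁ P₂ P₃ T)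

-- Under (B) there is no counterexample to (A): with K = 2n² + 1 and N₀
-- from sublinearity, the blow-up with h = 1 + N₀ + n has order N ≥ N₀ and
-- K·h ≤ K·f(G⁺) ≤ K·g(N) ≤ N < K·h.
B-excludes-counterexamples : StatementB → ∀ n (G : Graph n) P₁ P₂ P₃ → ThreeLongest G P₁ P₂ P₃ →
                             ¬ (∀ v → Any (v ∉_) (P₁ ∷ P₂ ∷ P₃ ∷ []))
B-excludes-counterexamples (g , _ , sublinear , bounded) n G P₁ P₂ P₃ T@(conn , L₁ , L₂ , L₃ , _) missed =
  <-irrefl refl (begin-strict
    K * h      ≤⟨ *-monoʳ-≤ K (≤-trans f≥h f≤g) ⟩
    K * g N    ≤⟨ proj₂ (sublinear K) N N₀≤N ⟩
    N          <⟨ blowup-order-< n h (s≤s (m≤n+m n N₀)) ⟩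
    K * h      ∎)
  where
  open ≤-Reasoning
  K = suc (n * (n * 2))
  N₀ = proj₁ (sublinear K)
  open Blowup G (N₀ + n)
  open Lifting
  f≥h : h ≤ f G⁺ (lift P₁ ∷ lift P₂ ∷ lift P₃ ∷ [])
  f≥h = f-lift-≥ (proj₁ conn) (P₁ ∷ P₂ ∷ P₃ ∷ []) (proj₁ L₁ ∷ proj₁ L₂ ∷ proj₁ L₃ ∷ []) missed
  f≤g : f G⁺ (lift P₁ ∷ lift P₂ ∷ lift P₃ ∷ []) ≤ g N
  f≤g = bounded N G⁺ (lift P₁) (lift P₂) (lift P₃) (lift-ThreeLongest T)
  N₀≤N : N₀ ≤ N
  N₀≤N = ≤-trans (≤-trans (m≤m+n N₀ n) (n≤1+n _)) (h≤N (proj₁ conn))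

theorem2 : StatementA ⇔ StatementB
theorem2 = mk⇔ A⇒B B⇒A
  where
  B⇒A : StatementB → StatementA
  B⇒A B n G P₁ P₂ P₃ T with common-or-missed (P₁ ∷ P₂ ∷ P₃ ∷ [])
  ... | inj₁ (v , on-all) = f-common-vertex G _ v on-all
  ... | inj₂ missed = ⊥-elim (B-excludes-counterexamples B n G P₁ P₂ P₃ T missed)
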